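{- Let $G$ be a finite simple graph and $s \geq 1$ an integer, and let $H_p = \{v \in V(G) \mid p(v) \geq s-1\}$. Then $G$ attains equality in the bound \[ N(G,K_s) \leq \frac{1}{s}\sum_{v \in V(G)}\binom{p(v)}{s-1} \] if and only if the induced subgraph $G[H_p]$ attains equality in the same bound applied to $G[H_p]$ (with weights computed in $G[H_p]$).
   Context: $N(G,K_s)$ denotes the number of subgraphs of $G$ isomorphic to $K_s$. For a graph $H$ and $v \in V(H)$, $p(v)$ is the length (number of edges) of the longest path of $H$ containing $v$. Binomial coefficients $\binom{a}{b}$ are $0$ when $a<b$. -}

module Defs where

open import Data.Bool using (Bool; true; false; _∧_; not; T)
open import Data.Nat using (ℕ; zero; suc; _∸_; _≡ᵇ_; _≤ᵇ_; _*_; _⊔_)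
open import Data.Nat.Combinatorics using (_C_)
open import Data.Fin using (Fin; _≟_)
open import Data.List using (List; []; _∷_; length; map; filterᵇ; foldr; concatMap; upTo; allFin)
open import Data.Bool.ListAction using (all; any)
open import Data.Nat.ListAction using (sum)
open import Relation.Nullary.Decidable using (⌊_⌋)
open import Relation.Binary.PropositionalEquality using (_≡_)

record Graph : Set where
  field
    n      : ℕ
    adj    : Fin n → Fin n → Bool
    sym    : ∀ u v → adj u v ≡ adj v u
    irrefl : ∀ v → adj v v ≡ false
open Graph public

-- A vertex subset S ⊆ V(G), as a Bool predicate.  All quantities below
-- are computed in the induced subgraph G[S].
VSet : Graph → Set
VSet G = Fin (n G) → Bool

full : (G : Graph) → VSet G
full G _ = true

verts : (G : Graph) → VSet G → List (Fin (n G))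
verts G S = filterᵇ S (allFin (n G))

-- all (order-preserving) sublists = all subsets of a duplicate-free list
sublists : {A : Set} → List A → List (List A)
sublists [] = [] ∷ []
sublists (x ∷ xs) = let r = sublists xs in map (x ∷_) r Data.List.++ r

isClique : (G : Graph) → List (Fin (n G)) → Bool
isClique G [] = true
isClique G (x ∷ xs) = all (adj G x) xs ∧ isClique G xs

NK : (G : Graph) → VSet G → ℕ → ℕ
NK G S s = length (filterᵇ (λ l → (length l ≡ᵇ s) ∧ isClique G l) (sublists (verts G S)))

seqs : (G : Graph) → VSet G → ℕ → List (List (Fin (n G)))
seqs G S zero = [] ∷ []
seqs G S (suc k) = concatMap (λ x → map (x ∷_) (seqs G S k)) (verts G S)

eqᵇ : {m : ℕ} → Fin m → Fin m → Bool
eqᵇ x y = ⌊ x ≟ y ⌋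

distinct : {m : ℕ} → List (Fin m) → Bool
distinct [] = true
distinct (x ∷ xs) = all (λ y → not (eqᵇ x y)) xs ∧ distinct xs

walk : (G : Graph) → List (Fin (n G)) → Bool
walk G [] = true
walk G (x ∷ []) = true
walk G (x ∷ y ∷ xs) = adj G x y ∧ walk G (y ∷ xs)

isPath : (G : Graph) → List (Fin (n G)) → Bool
isPath G l = distinct l ∧ walk G l

-- all paths of G[S] (a path has at most n vertices)
paths : (G : Graph) → VSet G → List (List (Fin (n G)))
paths G S = filterᵇ (isPath G) (concatMap (seqs G S) (upTo (suc (n G))))

-- p(v) in G[S]: the number of edges of a longest path of G[S] containing v
-- (maximum of (#vertices - 1) over paths through v; the one-vertex path
-- gives 0 as a base value)
plen : (G : Graph) → VSet G → Fin (n G) → ℕ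
plen G S v = foldr _⊔_ 0 (map (λ l → length l ∸ 1)
                               (filterᵇ (λ l → any (eqᵇ v) l) (paths G S)))

-- right-hand side times s:  Σ_{v ∈ S} binom(p(v), s-1)
weightSum : (G : Graph) → VSet G → ℕ → ℕ
weightSum G S s = sum (map (λ v → plen G S v C (s ∸ 1)) (verts G S))

Tight : (G : Graph) → VSet G → ℕ → Set
Tight G S s = s * NK G S s ≡ weightSum G S s

Hp : (G : Graph) → ℕ → VSet G
Hp G s v = (s ∸ 1) ≤ᵇ plen G (full G) v

{-# OPTIONS --safe #-}
module Submission where

-- Both sides of the bound are unchanged when G is replaced by G[H_p].
-- An s-clique, listed in any order, is a path with s - 1 edges through each of
-- its vertices, so every s-clique lies in H_p.  If v ∈ H_p and P is a longest
-- path through v, then P also passes through each of its vertices u, so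
-- p(u) ≥ p(v) ≥ s - 1; hence P lies in H_p and p(v) is the same in G and in
-- G[H_p].  For v ∉ H_p the binomial coefficient binom(p(v), s - 1) vanishes.

open import Defs
open import Data.Bool using (Bool; true; false; T; not; _∧_)
open import Data.Bool.Properties using (T-∧)
open import Data.Empty using (⊥-elim)
open import Data.Fin using (Fin; _≟_)
open import Data.List using (List; []; _∷_; _++_; length; map; filterᵇ; foldr; allFin)
open import Data.List.Properties
  using (foldr-preservesᵒ; filter-++; filter-none; filter-all; length-tabulate; map-cong-local)
open import Data.List.Membership.Propositional using (_∈_; find)
open import Data.List.Membership.Propositional.Properties
  using ( ∈-map⁺; ∈-map⁻; ∈-++⁻; ∈-filter⁺; ∈-filter⁻; ∈-concatMap⁺; ∈-concatMap⁻
        ; ∈-allFin; ∈-upTo⁺; ∈-upTo⁻; foldr-selective )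
open import Data.List.Relation.Unary.All as All using (All; []; _∷_)
open import Data.List.Relation.Unary.All.Properties using (all⁺; all⁻; all-filter; ++⁻; map⁻)
open import Data.List.Relation.Unary.Any as Any using (here; satisfied)
open import Data.List.Relation.Unary.Any.Properties using (any⁺; any⁻)
open import Data.Nat using (ℕ; zero; suc; _≥_; _≤_; _∸_; _⊔_; _≡ᵇ_; _+_; _*_; z≤n; s≤s)
open import Data.Nat.Properties
  using ( ≤-reflexive; ≤-trans; ≤-antisym; n≤1+n; ⊔-sel; m≤n⇒m≤n⊔o; m≤n⇒m≤o⊔n
        ; ≤⇒≤ᵇ; ≤ᵇ⇒≤; ≡ᵇ⇒≡; ≰⇒>; module ≤-Reasoning )
open import Data.Nat.Combinatorics using (_C_; k>n⇒nCk≡0)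
open import Data.Bool.ListAction using (any)
open import Data.Nat.ListAction using (sum)
open import Data.Product using (∃-syntax; _×_; _,_; proj₁; proj₂)
open import Data.Sum using (_⊎_; inj₁; inj₂; [_,_])
open import Function using (_∘_; id; Equivalence)
open import Function.Bundles using (_⇔_; mk⇔)
open import Relation.Nullary using (¬_; yes; no)
open import Relation.Nullary.Decidable using (T?; toWitness; fromWitness)
import Relation.Binary.PropositionalEquality as ≡
open ≡ using (_≡_; refl; cong; cong₂; subst; subst₂; module ≡-Reasoning)

filterᵇ-map : {A B : Set} (p : B → Bool) (f : A → B) (xs : List A) →
              filterᵇ p (map f xs) ≡ map f (filterᵇ (p ∘ f) xs)
filterᵇ-map p f [] = refl
filterᵇ-map p f (x ∷ xs) with p (f x)
... | true  = cong (f x ∷_) (filterᵇ-map p f xs)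
... | false = filterᵇ-map p f xs

sum-map-filterᵇ : {A : Set} (p : A → Bool) (f : A → ℕ) → (∀ x → ¬ T (p x) → f x ≡ 0) →
                  (xs : List A) → sum (map f (filterᵇ p xs)) ≡ sum (map f xs)
sum-map-filterᵇ p f f-off [] = refl
sum-map-filterᵇ p f f-off (x ∷ xs) with p x in px
... | true  = cong (f x +_) (sum-map-filterᵇ p f f-off xs)
... | false = cong₂ _+_ (≡.sym (f-off x (subst T px))) (sum-map-filterᵇ p f f-off xs)

∈⇒≤-foldr-⊔ : {m : ℕ} {ms : List ℕ} → m ∈ ms → m ≤ foldr _⊔_ 0 ms
∈⇒≤-foldr-⊔ {ms = ms} m∈ms = foldr-preservesᵒ
  (λ a b → [ m≤n⇒m≤n⊔o b , m≤n⇒m≤o⊔n a ]) 0 ms (inj₂ (Any.map ≤-reflexive m∈ms))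

module _ {A : Set} where

  ∈-sublists⇒length≤ : {l xs : List A} → l ∈ sublists xs → length l ≤ length xs
  ∈-sublists⇒length≤ {xs = []} (here refl) = z≤n
  ∈-sublists⇒length≤ {xs = x ∷ xs} l∈ with ∈-++⁻ (map (x ∷_) (sublists xs)) l∈
  ... | inj₁ l∈withx with ∈-map⁻ (x ∷_) l∈withx
  ...   | _ , l′∈ , refl = s≤s (∈-sublists⇒length≤ {xs = xs} l′∈)
  ∈-sublists⇒length≤ {xs = x ∷ xs} l∈ | inj₂ l∈withoutx =
    ≤-trans (∈-sublists⇒length≤ {xs = xs} l∈withoutx) (n≤1+n _)

  filterᵇ-sublists-∷ : (q : List A → Bool) (x : A) (xs : List A) →
    filterᵇ q (sublists (x ∷ xs)) ≡
    map (x ∷_) (filterᵇ (q ∘ (x ∷_)) (sublists xs)) ++ filterᵇ q (sublists xs)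
  filterᵇ-sublists-∷ q x xs = ≡.trans (filter-++ (T? ∘ q) (map (x ∷_) (sublists xs)) _)
    (cong (_++ _) (filterᵇ-map q (x ∷_) (sublists xs)))

  filterᵇ-sublists-filterᵇ : (p : A → Bool) (q : List A → Bool) (xs : List A) →
    All (λ l → T (q l) → All (T ∘ p) l) (sublists xs) →
    filterᵇ q (sublists (filterᵇ p xs)) ≡ filterᵇ q (sublists xs)
  filterᵇ-sublists-filterᵇ p q [] _ = refl
  filterᵇ-sublists-filterᵇ p q (x ∷ xs) qs⊆p
    with p x in px | ++⁻ (map (x ∷_) (sublists xs)) qs⊆p
  ... | true | with-x , without-x = begin
    filterᵇ q (sublists (x ∷ filterᵇ p xs))
      ≡⟨ filterᵇ-sublists-∷ q x (filterᵇ p xs) ⟩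
    map (x ∷_) (filterᵇ (q ∘ (x ∷_)) (sublists (filterᵇ p xs))) ++ filterᵇ q (sublists (filterᵇ p xs))
      ≡⟨ cong₂ (λ ys zs → map (x ∷_) ys ++ zs)
           (filterᵇ-sublists-filterᵇ p (q ∘ (x ∷_)) xs (All.map (All.tail ∘_) (map⁻ with-x)))
           (filterᵇ-sublists-filterᵇ p q xs without-x) ⟩
    map (x ∷_) (filterᵇ (q ∘ (x ∷_)) (sublists xs)) ++ filterᵇ q (sublists xs)
      ≡⟨ filterᵇ-sublists-∷ q x xs ⟨
    filterᵇ q (sublists (x ∷ xs)) ∎
    where open ≡-Reasoning
  ... | false | with-x , without-x = begin
    filterᵇ q (sublists (filterᵇ p xs))
      ≡⟨ filterᵇ-sublists-filterᵇ p q xs without-x ⟩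
    filterᵇ q (sublists xs)
      ≡⟨ cong (λ ys → map (x ∷_) ys ++ filterᵇ q (sublists xs))
           (filter-none (T? ∘ q ∘ (x ∷_))
              (All.map (λ q⇒p → subst T px ∘ All.head ∘ q⇒p) (map⁻ with-x))) ⟨
    map (x ∷_) (filterᵇ (q ∘ (x ∷_)) (sublists xs)) ++ filterᵇ q (sublists xs)
      ≡⟨ filterᵇ-sublists-∷ q x xs ⟨
    filterᵇ q (sublists (x ∷ xs)) ∎
    where open ≡-Reasoning

module _ {m : ℕ} {v : Fin m} {l : List (Fin m)} where

  ∈⇒any-eqᵇ : v ∈ l → T (any (eqᵇ v) l)
  ∈⇒any-eqᵇ = any⁺ (eqᵇ v) ∘ Any.map fromWitness

  any-eqᵇ⇒∈ : T (any (eqᵇ v) l) → v ∈ l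
  any-eqᵇ⇒∈ = Any.map toWitness ∘ any⁻ (eqᵇ v) l

module _ (G : Graph) where

  ∈-verts⁺ : (S : VSet G) {x : Fin (n G)} → T (S x) → x ∈ verts G S
  ∈-verts⁺ S = ∈-filter⁺ (T? ∘ S) (∈-allFin _)

  ∈-seqs⁺ : (S : VSet G) {l : List (Fin (n G))} → All (T ∘ S) l → l ∈ seqs G S (length l)
  ∈-seqs⁺ S [] = here refl
  ∈-seqs⁺ S {x ∷ l} (Sx ∷ Sl) = ∈-concatMap⁺ (λ y → map (y ∷_) (seqs G S (length l)))
    (Any.map (λ { refl → ∈-map⁺ (x ∷_) (∈-seqs⁺ S Sl) }) (∈-verts⁺ S Sx))

  ∈-seqs⁻ : (S : VSet G) (k : ℕ) {l : List (Fin (n G))} → l ∈ seqs G S k → length l ≡ k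
  ∈-seqs⁻ S zero (here refl) = refl
  ∈-seqs⁻ S (suc k) l∈
    with satisfied (∈-concatMap⁻ (λ y → map (y ∷_) (seqs G S k)) {xs = verts G S} l∈)
  ... | y , l∈y∷ with ∈-map⁻ (y ∷_) l∈y∷
  ...   | _ , l′∈ , refl = cong suc (∈-seqs⁻ S k l′∈)

  ∈-paths⁺ : (S : VSet G) {l : List (Fin (n G))} →
             T (isPath G l) → length l ≤ n G → All (T ∘ S) l → l ∈ paths G S
  ∈-paths⁺ S path len≤n Sl = ∈-filter⁺ (T? ∘ isPath G)
    (∈-concatMap⁺ (seqs G S) (Any.map (λ { refl → ∈-seqs⁺ S Sl }) (∈-upTo⁺ (s≤s len≤n)))) path

  ∈-paths⁻ : (S : VSet G) {l : List (Fin (n G))} →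
             l ∈ paths G S → T (isPath G l) × length l ≤ n G
  ∈-paths⁻ S l∈ with ∈-filter⁻ (T? ∘ isPath G) l∈
  ... | l∈seqs , path with find (∈-concatMap⁻ (seqs G S) l∈seqs)
  ...   | k , k∈ , l∈seqsk with ∈-upTo⁻ k∈
  ...     | s≤s k≤n = path , ≤-trans (≤-reflexive (∈-seqs⁻ S k l∈seqsk)) k≤n

  ∈-paths-within : (S S′ : VSet G) {l : List (Fin (n G))} →
                   l ∈ paths G S → All (T ∘ S′) l → l ∈ paths G S′
  ∈-paths-within S S′ l∈ S′l = let path , len≤n = ∈-paths⁻ S l∈ in ∈-paths⁺ S′ path len≤n S′l

  length∸1≤plen : (S : VSet G) {v : Fin (n G)} {l : List (Fin (n G))} →
                  l ∈ paths G S → v ∈ l → length l ∸ 1 ≤ plen G S v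
  length∸1≤plen S l∈ v∈l =
    ∈⇒≤-foldr-⊔ (∈-map⁺ (λ l → length l ∸ 1) (∈-filter⁺ (T? ∘ any (eqᵇ _)) l∈ (∈⇒any-eqᵇ v∈l)))

  LongestPath : VSet G → Fin (n G) → List (Fin (n G)) → Set
  LongestPath S v l = l ∈ paths G S × v ∈ l × plen G S v ≡ length l ∸ 1

  plen-attained : (S : VSet G) (v : Fin (n G)) → plen G S v ≡ 0 ⊎ ∃[ l ] LongestPath S v l
  plen-attained S v
    with foldr-selective ⊔-sel 0 (map (λ l → length l ∸ 1) (filterᵇ (any (eqᵇ v)) (paths G S)))
  ... | inj₁ plen≡0 = inj₁ plen≡0
  ... | inj₂ plen∈ with ∈-map⁻ (λ l → length l ∸ 1) plen∈
  ...   | l , l∈ , plen≡ with ∈-filter⁻ (T? ∘ any (eqᵇ v)) l∈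
  ...     | l∈paths , v∈l = inj₂ (l , l∈paths , any-eqᵇ⇒∈ v∈l , plen≡)

  plen-mono : (S S′ : VSet G) (v : Fin (n G)) →
              (∀ {l} → LongestPath S v l → All (T ∘ S′) l) → plen G S v ≤ plen G S′ v
  plen-mono S S′ v longest⊆S′ with plen-attained S v
  ... | inj₁ plen≡0 = ≤-trans (≤-reflexive plen≡0) z≤n
  ... | inj₂ (l , longest@(l∈ , v∈l , plen≡)) = ≤-trans (≤-reflexive plen≡)
    (length∸1≤plen S′ (∈-paths-within S S′ l∈ (longest⊆S′ longest)) v∈l)

  all-full : (l : List (Fin (n G))) → All (T ∘ full G) l
  all-full = All.universal _

  verts-full : verts G (full G) ≡ allFin (n G)
  verts-full = filter-all (T? ∘ full G) (all-full (allFin (n G)))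

  adj⇒≢ : {x y : Fin (n G)} → T (adj G x y) → T (not (eqᵇ x y))
  adj⇒≢ {x} {y} xy with x ≟ y
  ... | yes refl = ⊥-elim (subst T (irrefl G x) xy)
  ... | no _ = _

  clique⇒distinct : (l : List (Fin (n G))) → T (isClique G l) → T (distinct l)
  clique⇒distinct [] _ = _
  clique⇒distinct (x ∷ xs) clique =
    let x-adj , xs-clique = Equivalence.to T-∧ clique
    in  Equivalence.from T-∧ ( all⁻ (not ∘ eqᵇ x) (All.map adj⇒≢ (all⁺ (adj G x) xs x-adj))
                             , clique⇒distinct xs xs-clique )

  clique⇒walk : (l : List (Fin (n G))) → T (isClique G l) → T (walk G l)
  clique⇒walk [] _ = _
  clique⇒walk (x ∷ []) _ = _
  clique⇒walk (x ∷ y ∷ xs) clique =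
    let x-adj , yxs-clique = Equivalence.to T-∧ clique
    in  Equivalence.from T-∧ ( proj₁ (Equivalence.to (T-∧ {adj G x y}) x-adj)
                             , clique⇒walk (y ∷ xs) yxs-clique )

  clique⇒path : (l : List (Fin (n G))) → T (isClique G l) → T (isPath G l)
  clique⇒path l clique = Equivalence.from T-∧ (clique⇒distinct l clique , clique⇒walk l clique)

  module _ (s : ℕ) where

    IsSClique : List (Fin (n G)) → Bool
    IsSClique l = (length l ≡ᵇ s) ∧ isClique G l

    sClique⊆Hp : {l : List (Fin (n G))} → l ∈ sublists (allFin (n G)) → T (IsSClique l) →
                 All (T ∘ Hp G s) l
    sClique⊆Hp {l} l∈ sClique = All.tabulate λ {u} u∈l → ≤⇒≤ᵇ (begin
      s ∸ 1             ≡⟨ cong (_∸ 1) length≡s ⟨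
      length l ∸ 1      ≤⟨ length∸1≤plen (full G) l∈paths u∈l ⟩
      plen G (full G) u ∎)
      where
      open ≤-Reasoning
      length≡s : length l ≡ s
      length≡s = ≡ᵇ⇒≡ (length l) s (proj₁ (Equivalence.to T-∧ sClique))
      length≤n : length l ≤ n G
      length≤n = ≤-trans (∈-sublists⇒length≤ {xs = allFin (n G)} l∈)
                         (≤-reflexive (length-tabulate id))
      l∈paths : l ∈ paths G (full G)
      l∈paths = ∈-paths⁺ (full G) (clique⇒path l (proj₂ (Equivalence.to T-∧ sClique)))
                         length≤n (all-full l)

    longestPath⊆Hp : {v : Fin (n G)} → T (Hp G s v) →
                     ∀ {l} → LongestPath (full G) v l → All (T ∘ Hp G s) l
    longestPath⊆Hp {v} v∈Hp {l} (l∈ , _ , plen≡) = All.tabulate λ {u} u∈l → ≤⇒≤ᵇ (begin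
      s ∸ 1                  ≤⟨ ≤ᵇ⇒≤ _ _ v∈Hp ⟩
      plen G (full G) v      ≡⟨ plen≡ ⟩
      length l ∸ 1           ≤⟨ length∸1≤plen (full G) l∈ u∈l ⟩
      plen G (full G) u      ∎)
      where open ≤-Reasoning

    plen-Hp : {v : Fin (n G)} → T (Hp G s v) → plen G (Hp G s) v ≡ plen G (full G) v
    plen-Hp {v} v∈Hp = ≤-antisym
      (plen-mono (Hp G s) (full G) v (λ {l} _ → all-full l))
      (plen-mono (full G) (Hp G s) v (longestPath⊆Hp v∈Hp))

    NK-Hp : NK G (full G) s ≡ NK G (Hp G s) s
    NK-Hp = cong length (begin
      filterᵇ IsSClique (sublists (verts G (full G)))
        ≡⟨ cong (filterᵇ IsSClique ∘ sublists) verts-full ⟩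
      filterᵇ IsSClique (sublists (allFin (n G)))
        ≡⟨ filterᵇ-sublists-filterᵇ (Hp G s) IsSClique (allFin (n G)) (All.tabulate sClique⊆Hp) ⟨
      filterᵇ IsSClique (sublists (verts G (Hp G s))) ∎)
      where open ≡-Reasoning

    weightSum-Hp : weightSum G (full G) s ≡ weightSum G (Hp G s) s
    weightSum-Hp = begin
      sum (map weight (verts G (full G)))
        ≡⟨ cong (sum ∘ map weight) verts-full ⟩
      sum (map weight (allFin (n G)))
        ≡⟨ sum-map-filterᵇ (Hp G s) weight weight-off (allFin (n G)) ⟨
      sum (map weight (verts G (Hp G s)))
        ≡⟨ cong sum (map-cong-local (All.map (cong (_C (s ∸ 1)) ∘ ≡.sym ∘ plen-Hp)
                                             (all-filter (T? ∘ Hp G s) (allFin (n G))))) ⟩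
      sum (map (λ v → plen G (Hp G s) v C (s ∸ 1)) (verts G (Hp G s))) ∎
      where
      open ≡-Reasoning
      weight : Fin (n G) → ℕ
      weight v = plen G (full G) v C (s ∸ 1)
      weight-off : ∀ v → ¬ T (Hp G s v) → weight v ≡ 0
      weight-off v v∉Hp = k>n⇒nCk≡0 {plen G (full G) v} {s ∸ 1} (≰⇒> (v∉Hp ∘ ≤⇒≤ᵇ))

lemma2p50 : (G : Graph) (s : ℕ) → s ≥ 1 →
    (Tight G (full G) s ⇔ Tight G (Hp G s) s)
lemma2p50 G s _ = mk⇔
  (subst₂ tight (NK-Hp G s) (weightSum-Hp G s))
  (subst₂ tight (≡.sym (NK-Hp G s)) (≡.sym (weightSum-Hp G s)))
  where
  tight : ℕ → ℕ → Set
  tight N W = s * N ≡ W
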